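{- Every (finite) tree is an ENPT graph; that is, for every tree $T'$ there exist a tree $T$ and a set $\mathcal{P}$ of non-trivial simple paths in $T$ such that $\mathrm{ENPT}(T,\mathcal{P})$ is isomorphic to $T'$.
   Context: Given a tree $T$ and a set $\mathcal{P}=\{P_v\}$ of non-trivial simple paths in $T$ (each with at least one edge), two paths $P,P'$ are non-splitting if they share at least one edge and no vertex has degree at least $3$ in their union $P\cup P'$ (equivalently, $P\cup P'$ is a path). The graph $\mathrm{ENPT}(T,\mathcal{P})$ has a vertex $v$ for each path $P_v\in\mathcal{P}$, with $u,v$ adjacent iff $P_u$ and $P_v$ are non-splitting. A graph $G$ is an ENPT graph if $G$ is isomorphic to $\mathrm{ENPT}(T,\mathcal{P})$ for some such $T,\mathcal{P}$. -}

module Defs where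

open import Data.Nat using (ℕ; _≤_)
open import Data.Fin using (Fin)
open import Data.List using (List; []; _∷_; _++_; _∷ʳ_; length)
open import Data.List.Relation.Unary.Linked using (Linked)
open import Data.List.Relation.Unary.Unique.Propositional using (Unique)
open import Data.Product using (Σ; _×_; ∃-syntax)
open import Data.Sum using (_⊎_)
open import Relation.Nullary using (¬_)
open import Relation.Binary.PropositionalEquality using (_≡_; _≢_)
open import Function.Bundles using (_↔_; _⇔_; Inverse)
open import Level using (0ℓ)

record Graph (n : ℕ) : Set₁ where
  field
    Adj   : Fin n → Fin n → Set
    sym   : ∀ {u v} → Adj u v → Adj v u
    irrefl : ∀ {u} → ¬ Adj u u
open Graph public

module _ {n : ℕ} (G : Graph n) where
  IsPath : List (Fin n) → Set
  IsPath xs = Linked (Adj G) xs × Unique xs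

  Connected : Set
  Connected = ∀ u v → u ≡ v ⊎ (∃[ xs ] Linked (Adj G) (u ∷ xs ∷ʳ v))

  HasCycle : Set
  HasCycle = ∃[ u ] ∃[ xs ] (2 ≤ length xs × Unique (u ∷ xs) × Linked (Adj G) (u ∷ xs ∷ʳ u))

  IsTree : Set
  IsTree = 1 ≤ n × Connected × ¬ HasCycle

  NontrivialPath : List (Fin n) → Set
  NontrivialPath xs = IsPath xs × 2 ≤ length xs

module _ {n : ℕ} where
  Consec : List (Fin n) → Fin n → Fin n → Set
  Consec p x y = ∃[ as ] ∃[ bs ] p ≡ as ++ x ∷ y ∷ bs

  PathEdge : List (Fin n) → Fin n → Fin n → Set
  PathEdge p x y = Consec p x y ⊎ Consec p y x

  -- p and q have the same edge set (i.e. are the same path)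
  SameEdges : List (Fin n) → List (Fin n) → Set
  SameEdges p q = ∀ x y → PathEdge p x y ⇔ PathEdge q x y

  ShareEdge : List (Fin n) → List (Fin n) → Set
  ShareEdge p q = ∃[ x ] ∃[ y ] (PathEdge p x y × PathEdge q x y)

  UnionEdge : List (Fin n) → List (Fin n) → Fin n → Fin n → Set
  UnionEdge p q x y = PathEdge p x y ⊎ PathEdge q x y

  HasBranch : List (Fin n) → List (Fin n) → Set
  HasBranch p q = ∃[ x ] ∃[ a ] ∃[ b ] ∃[ c ]
    (a ≢ b × a ≢ c × b ≢ c × UnionEdge p q x a × UnionEdge p q x b × UnionEdge p q x c)

  NonSplitting : List (Fin n) → List (Fin n) → Set
  NonSplitting p q = ShareEdge p q × ¬ HasBranch p q

ENPTAdj : ∀ {N m} → (Fin m → List (Fin N)) → Fin m → Fin m → Set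
ENPTAdj P i j = i ≢ j × NonSplitting (P i) (P j)

IsoENPT : ∀ {k N m} → Graph k → (Fin m → List (Fin N)) → Set
IsoENPT {k} {N} {m} T' P =
  Σ (Fin k ↔ Fin m) λ f → ∀ u v → Adj T' u v ⇔ ENPTAdj P (Inverse.to f u) (Inverse.to f v)

module Submission where

-- Root T' at a vertex by breadth-first search, which gives every vertex a depth and a parent.
-- The host tree T is T' with a stem of two new vertices placed above the root, so that every
-- vertex z of T' has a grandparent in T; to z we assign the vertical path
-- grandparent(z) – parent(z) – z.  Two such paths are non-splitting exactly when one of the
-- vertices is the parent of the other: the paths of a parent and a child are the two
-- overlapping subpaths of a simple four-vertex path, the paths of siblings branch at their
-- common parent, and any other two paths share no edge.  So the identity on vertices is an
-- isomorphism from T' onto ENPT(T, P).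

open import Defs hiding (sym)
open import Function using (flip; _∘_)
open import Function.Bundles using (_⇔_; mk⇔; Equivalence)
open import Function.Construct.Identity using (↔-id)
open import Data.Nat using (ℕ; zero; suc; _≤_; _<_; z≤n; s≤s)
open import Data.Nat.Properties
  using (≤-refl; ≤-reflexive; ≤-antisym; ≤-pred; <-trans; <-irrefl; <-cmp; ≮⇒≥; 1+n≰n; m≤n⇒m≤1+n;
         m<1+n⇒m<n∨m≡n; n≤0⇒n≡0; suc-injective)
open import Data.Fin using (Fin; zero; suc)
open import Data.Fin.Properties using (_≟_; any?)
import Data.Fin.Properties as Finₚ
open import Data.List using (List; []; _∷_; _++_; _∷ʳ_; length)
open import Data.List.Properties using (∷-injective; ∷-injectiveˡ; ∷-injectiveʳ; ∷ʳ-injectiveʳ; ++-assoc)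
open import Data.List.Relation.Unary.Linked as Linked using (Linked; []; [-]; _∷_)
open import Data.List.Relation.Unary.Linked.Properties using (Linked⇒AllPairs)
open import Data.List.Relation.Unary.All as All using (All; []; _∷_)
open import Data.List.Relation.Unary.All.Properties using (All¬⇒¬Any; ¬Any⇒All¬; ∷ʳ⁺; ∷ʳ⁻; ++⁻ˡ)
open import Data.List.Relation.Unary.AllPairs as AllPairs using ([]; _∷_)
import Data.List.Relation.Unary.AllPairs.Properties as AllPairsₚ
open import Data.List.Relation.Unary.Unique.Propositional using (Unique)
open import Data.List.Relation.Unary.Any using (here; there)
open import Data.List.Membership.Propositional using (_∈_)
open import Data.List.Membership.Propositional.Properties using (∈-++⁺ʳ; ∈-∃++)
open import Data.Product using (Σ; _×_; _,_; ∃; ∃-syntax; proj₁; proj₂)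
import Data.Product as Product
open import Data.Sum using (_⊎_; inj₁; inj₂; [_,_])
import Data.Sum as Sum
open import Data.Empty using (⊥; ⊥-elim)
open import Data.Unit using (⊤; tt)
open import Relation.Nullary using (¬_; Dec; yes; no)
open import Relation.Nullary.Decidable using (_×-dec_)
open import Relation.Binary.Definitions using (tri<; tri≈; tri>)
open import Relation.Binary.PropositionalEquality using (_≡_; _≢_; refl; sym; trans; cong; subst; ≢-sym)
open import Relation.Binary.Construct.Closure.ReflexiveTransitive as Star using (Star; ε; _◅_; _◅◅_)

module _ {A : Set} where

  linked-∷ʳ : ∀ {R : A → A → Set} xs {y z} → Linked R (xs ∷ʳ y) → R y z → Linked R (xs ∷ʳ y ∷ʳ z)
  linked-∷ʳ []            _         r = r ∷ [-]
  linked-∷ʳ (x ∷ [])      (r′ ∷ _)  r = r′ ∷ r ∷ [-]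
  linked-∷ʳ (x ∷ x′ ∷ xs) (r′ ∷ rs) r = r′ ∷ linked-∷ʳ (x′ ∷ xs) rs r

  linked-++⁻ˡ : ∀ {R : A → A → Set} xs {ys} → Linked R (xs ++ ys) → Linked R xs
  linked-++⁻ˡ []            _        = []
  linked-++⁻ˡ (x ∷ [])      _        = [-]
  linked-++⁻ˡ (x ∷ x′ ∷ xs) (r ∷ rs) = r ∷ linked-++⁻ˡ (x′ ∷ xs) rs

  unique-++⁻ˡ : ∀ xs {ys} → Unique (xs ++ ys) → Unique {A = A} xs
  unique-++⁻ˡ []       _        = []
  unique-++⁻ˡ (x ∷ xs) (x∉ ∷ u) = ++⁻ˡ xs x∉ ∷ unique-++⁻ˡ xs u

  unique-∷ʳ : ∀ {xs z} → Unique {A = A} xs → All (_≢ z) xs → Unique (xs ∷ʳ z)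
  unique-∷ʳ u x≢z = AllPairsₚ.++⁺ u ([] ∷ []) (All.map (_∷ []) x≢z)

  closed-not-unique : ∀ {u : A} xs → ¬ Unique (u ∷ xs ∷ʳ u)
  closed-not-unique xs (u∉ ∷ _) = proj₂ (∷ʳ⁻ u∉) refl

  strict-chain-unique : ∀ {R : A → A → Set} → (∀ {x y z} → R x y → R y z → R x z) →
                        (∀ {x} → ¬ R x x) → ∀ {xs} → Linked R xs → Unique xs
  strict-chain-unique trans irrefl chain =
    AllPairs.map (λ { r refl → irrefl r }) (Linked⇒AllPairs trans chain)

  occurrence-unique : ∀ {L : List A} {x} as {bs} as′ {bs′} → Unique L →
                      L ≡ as ++ x ∷ bs → L ≡ as′ ++ x ∷ bs′ → as ≡ as′ × bs ≡ bs′
  occurrence-unique []       []         _        refl eq = refl , ∷-injectiveʳ eq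
  occurrence-unique {x = x} [] (c ∷ cs) (x∉ ∷ _) refl eq =
    ⊥-elim (All¬⇒¬Any x∉ (subst (x ∈_) (sym (∷-injectiveʳ eq)) (∈-++⁺ʳ cs (here refl))))
  occurrence-unique {x = x} (c ∷ cs) [] (c∉ ∷ _) refl eq =
    ⊥-elim (All¬⇒¬Any c∉ (subst (λ c → c ∈ cs ++ x ∷ _) (sym (∷-injectiveˡ eq)) (∈-++⁺ʳ cs (here refl))))
  occurrence-unique (c ∷ cs) (c′ ∷ cs′) (_ ∷ u) refl eq with ∷-injective eq
  ... | refl , eq′ = Product.map₁ (cong (c ∷_)) (occurrence-unique cs cs′ u refl eq′)

  star⇒linked : ∀ {R : A → A → Set} {x y} → Star R x y → x ≡ y ⊎ ∃[ xs ] Linked R (x ∷ xs ∷ʳ y)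
  star⇒linked ε = inj₁ refl
  star⇒linked (r ◅ rs) with star⇒linked rs
  ... | inj₁ refl      = inj₂ ([] , r ∷ [-])
  ... | inj₂ (xs , l)  = inj₂ (_ ∷ xs , r ∷ l)

  NoBacktrack : List A → Set
  NoBacktrack (a ∷ b ∷ c ∷ L) = a ≢ c × NoBacktrack (b ∷ c ∷ L)
  NoBacktrack _               = ⊤

  no-backtrack-∷ʳ : ∀ a b c L {z} → Unique (a ∷ b ∷ c ∷ L) → All (_≢ z) (b ∷ c ∷ L) →
                    NoBacktrack (a ∷ b ∷ c ∷ L ∷ʳ z)
  no-backtrack-∷ʳ a b c []      ((_ ∷ a≢c ∷ _) ∷ _) (b≢z ∷ _) = a≢c , b≢z , tt
  no-backtrack-∷ʳ a b c (d ∷ L) ((_ ∷ a≢c ∷ _) ∷ u) (_ ∷ ≢z)  = a≢c , no-backtrack-∷ʳ b c d L u ≢z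

  LastLink : (A → A → Set) → List A → Set
  LastLink R (a ∷ b ∷ [])    = R a b
  LastLink R (a ∷ b ∷ c ∷ L) = LastLink R (b ∷ c ∷ L)
  LastLink R _               = ⊥

  last-link-source : ∀ {R : A → A → Set} a b L z → LastLink R (a ∷ b ∷ L ∷ʳ z) → ∃[ w ] (w ∈ b ∷ L × R w z)
  last-link-source a b []      z r = b , here refl , r
  last-link-source a b (c ∷ L) z r with last-link-source b c L z r
  ... | w , w∈ , r′ = w , there w∈ , r′

Least : (ℕ → Set) → ℕ → Set
Least P m = P m × (∀ j → P j → m ≤ j)

least-below : ∀ {P : ℕ → Set} → (∀ m → Dec (P m)) → ∀ n → ∃ (Least P) ⊎ (∀ j → j < n → ¬ P j)
least-below P? zero = inj₂ λ _ ()
least-below P? (suc n) with least-below P? n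
... | inj₁ found = inj₁ found
... | inj₂ none with P? n
...   | yes pn = inj₁ (n , pn , λ j pj → ≮⇒≥ λ j<n → none j j<n pj)
...   | no ¬pn = inj₂ λ j j<1+n pj →
          [ (λ j<n → none j j<n pj) , (λ { refl → ¬pn pj }) ] (m<1+n⇒m<n∨m≡n j<1+n)

least : ∀ {P : ℕ → Set} → (∀ m → Dec (P m)) → ∀ {n} → P n → ∃ (Least P)
least P? {n} pn with least-below P? (suc n)
... | inj₁ found = found
... | inj₂ none  = ⊥-elim (none n ≤-refl pn)

module _ {n : ℕ} where

  consec-++ʳ : ∀ {p x y} ys → Consec {n} p x y → Consec (p ++ ys) x y
  consec-++ʳ ys (as , bs , refl) = as , bs ++ ys , ++-assoc as (_ ∷ _ ∷ bs) ys

  consec-∷ : ∀ {p x y} w → Consec {n} p x y → Consec (w ∷ p) x y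
  consec-∷ w (as , bs , eq) = w ∷ as , bs , cong (w ∷_) eq

  consec-three : ∀ {a b c x y : Fin n} → Consec (a ∷ b ∷ c ∷ []) x y → (x ≡ a × y ≡ b) ⊎ (x ≡ b × y ≡ c)
  consec-three ([] , _ , refl)                  = inj₁ (refl , refl)
  consec-three (_ ∷ [] , _ , refl)              = inj₂ (refl , refl)
  consec-three (_ ∷ _ ∷ [] , _ , ())
  consec-three (_ ∷ _ ∷ _ ∷ [] , _ , ())
  consec-three (_ ∷ _ ∷ _ ∷ _ ∷ _ , _ , ())

  successor-unique : ∀ {L x a b} → Unique L → Consec {n} L x a → Consec L x b → a ≡ b
  successor-unique u (as , _ , eq) (as′ , _ , eq′) =
    ∷-injectiveˡ (proj₂ (occurrence-unique as as′ u eq eq′))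

  predecessor-unique : ∀ {L x a b} → Unique L → Consec {n} L a x → Consec L b x → a ≡ b
  predecessor-unique {a = a} {b} u (as , bs , eq) (as′ , bs′ , eq′) =
    ∷ʳ-injectiveʳ as as′ (proj₁ (occurrence-unique (as ∷ʳ a) (as′ ∷ʳ b) u
      (trans eq (sym (++-assoc as (a ∷ []) _))) (trans eq′ (sym (++-assoc as′ (b ∷ []) _)))))

  path-degree≤2 : ∀ {L x a b c} → Unique L → PathEdge {n} L x a → PathEdge L x b → PathEdge L x c →
                  a ≢ b → a ≢ c → b ≢ c → ⊥
  path-degree≤2 u (inj₁ p) (inj₁ q) _        a≢b _   _   = a≢b (successor-unique u p q)
  path-degree≤2 u (inj₂ p) (inj₂ q) _        a≢b _   _   = a≢b (predecessor-unique u p q)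
  path-degree≤2 u (inj₁ p) (inj₂ q) (inj₁ r) _   a≢c _   = a≢c (successor-unique u p r)
  path-degree≤2 u (inj₁ p) (inj₂ q) (inj₂ r) _   _   b≢c = b≢c (predecessor-unique u q r)
  path-degree≤2 u (inj₂ p) (inj₁ q) (inj₁ r) _   _   b≢c = b≢c (successor-unique u q r)
  path-degree≤2 u (inj₂ p) (inj₁ q) (inj₂ r) _   a≢c _   = a≢c (predecessor-unique u p r)

  no-branch-within : ∀ {L p q} → Unique L → (∀ {x y} → UnionEdge {n} p q x y → PathEdge L x y) →
                     ¬ HasBranch p q
  no-branch-within u ⊆L (_ , _ , _ , _ , a≢b , a≢c , b≢c , ea , eb , ec) =
    path-degree≤2 u (⊆L ea) (⊆L eb) (⊆L ec) a≢b a≢c b≢c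

  nonsplitting-sym : ∀ {p q} → NonSplitting {n} p q → NonSplitting q p
  nonsplitting-sym ((x , y , e , e′) , no-branch) =
    (x , y , e′ , e) ,
    λ (v , a , b , c , a≢b , a≢c , b≢c , ea , eb , ec) →
      no-branch (v , a , b , c , a≢b , a≢c , b≢c , Sum.swap ea , Sum.swap eb , Sum.swap ec)

  overlap-nonsplitting : ∀ {w₀ w₁ w₂ w₃} → Unique (w₀ ∷ w₁ ∷ w₂ ∷ w₃ ∷ []) →
                         NonSplitting {n} (w₀ ∷ w₁ ∷ w₂ ∷ []) (w₁ ∷ w₂ ∷ w₃ ∷ [])
  overlap-nonsplitting {w₀} {w₁} {w₂} {w₃} u =
    (w₁ , w₂ , inj₁ (w₀ ∷ [] , [] , refl) , inj₁ ([] , w₃ ∷ [] , refl)) ,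
    no-branch-within u [ Sum.map (consec-++ʳ (w₃ ∷ [])) (consec-++ʳ (w₃ ∷ []))
                       , Sum.map (consec-∷ w₀) (consec-∷ w₀) ]

module Paths {n : ℕ} (G : Graph n) where
  open import Data.List.Membership.DecPropositional (_≟_ {n}) using (_∈?_)

  SimplePath : Fin n → List (Fin n) → Fin n → Set
  SimplePath u ys v = IsPath G (u ∷ ys ∷ʳ v)

  path-prefix : ∀ xs {ys} → IsPath G (xs ++ ys) → IsPath G xs
  path-prefix xs = Product.map (linked-++⁻ˡ xs) (unique-++⁻ˡ xs)

  cons-path : ∀ {a u w} ys → Adj G a u → All (a ≢_) (u ∷ ys ∷ʳ w) → SimplePath u ys w →
              SimplePath a (u ∷ ys) w
  cons-path _ a fresh (lk , un) = a ∷ lk , fresh ∷ un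

  snoc-path : ∀ {u w z} ys → SimplePath u ys w → Adj G w z → All (_≢ z) (u ∷ ys ∷ʳ w) →
              SimplePath u (ys ∷ʳ w) z
  snoc-path {u} ys (lk , un) a fresh = linked-∷ʳ (u ∷ ys) lk a , unique-∷ʳ un fresh

  Reaches : Fin n → Fin n → Set
  Reaches u v = u ≡ v ⊎ ∃[ ys ] SimplePath u ys v

  -- Prolong by one edge; if its endpoint was visited before, cut the path back to that visit.
  extend : ∀ {u y z} → Reaches u y → Adj G y z → Reaches u z
  extend (inj₁ refl) a = inj₂ ([] , a ∷ [-] , ((λ { refl → irrefl G a }) ∷ []) ∷ [] ∷ [])
  extend {u} {y} {z} (inj₂ (ys , p)) a with z ∈? (u ∷ ys ∷ʳ y)
  ... | no z∉ = inj₂ (ys ∷ʳ y , snoc-path ys p a (All.map ≢-sym (¬Any⇒All¬ _ z∉)))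
  ... | yes z∈ with ∈-∃++ z∈
  ...   | []     , _  , eq = inj₁ (∷-injectiveˡ eq)
  ...   | _ ∷ as , bs , eq with refl ← ∷-injectiveˡ eq =
          inj₂ (as , path-prefix (u ∷ as ∷ʳ z) (subst (IsPath G) eq′ p))
    where eq′ : u ∷ ys ∷ʳ y ≡ (u ∷ as ∷ʳ z) ++ bs
          eq′ = trans eq (sym (++-assoc (u ∷ as) (z ∷ []) bs))

  walk⇒reaches : ∀ {u v} xs → Linked (Adj G) (u ∷ xs ∷ʳ v) → Reaches u v
  walk⇒reaches {u} xs = along u xs (inj₁ refl)
    where
    along : ∀ {v} y xs → Reaches u y → Linked (Adj G) (y ∷ xs ∷ʳ v) → Reaches u v
    along y []       r (a ∷ _) = extend r a
    along y (x ∷ xs) r (a ∷ l) = along x xs (extend r a) l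

  close-cycle : ∀ {u y ys w} → SimplePath u (y ∷ ys) w → Adj G w u → HasCycle G
  close-cycle {u} {y} {ys} {w} (lk , un) a =
    u , (y ∷ ys) ∷ʳ w , s≤s (nonempty ys) , un , linked-∷ʳ (u ∷ y ∷ ys) lk a
    where nonempty : ∀ zs → 1 ≤ length (zs ∷ʳ w)
          nonempty []      = s≤s z≤n
          nonempty (_ ∷ _) = s≤s z≤n

  -- In a connected acyclic graph adjacency is decidable: shorten a walk between the
  -- vertices to a simple path, which is a single edge or else closes a cycle with any edge.
  adjacent? : Connected G → ¬ HasCycle G → ∀ u v → Dec (Adj G u v)
  adjacent? connected acyclic u v with connected u v
  ... | inj₁ refl = no (irrefl G)
  ... | inj₂ (xs , walk) with walk⇒reaches xs walk
  ...   | inj₁ refl              = no (irrefl G)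
  ...   | inj₂ ([] , a ∷ _ , _)  = yes a
  ...   | inj₂ (_ ∷ _ , p)       = no λ a → acyclic (close-cycle p (Graph.sym G a))

record Rooting (n : ℕ) : Set where
  field
    root         : Fin n
    parent       : Fin n → Fin n
    depth        : Fin n → ℕ
    depth-root   : depth root ≡ 0
    depth-parent : ∀ v → v ≢ root → suc (depth (parent v)) ≡ depth v

module Rooted {n : ℕ} (ρ : Rooting n) where
  open Rooting ρ public

  ChildOf : Fin n → Fin n → Set
  ChildOf v u = v ≢ root × parent v ≡ u

  TreeEdge : Fin n → Fin n → Set
  TreeEdge u v = ChildOf u v ⊎ ChildOf v u

  child-deeper : ∀ {u v} → ChildOf v u → depth u < depth v
  child-deeper (v≢root , refl) = ≤-reflexive (depth-parent _ v≢root)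

  shallower⇒≢ : ∀ {u v} → depth u < depth v → u ≢ v
  shallower⇒≢ lt refl = <-irrefl refl lt

  no-mutual-children : ∀ {u v} → ChildOf u v → ChildOf v u → ⊥
  no-mutual-children u→v v→u = <-irrefl refl (<-trans (child-deeper u→v) (child-deeper v→u))

  descending-unique : ∀ {L} → Linked (flip ChildOf) L → Unique L
  descending-unique = strict-chain-unique <-trans (<-irrefl refl) ∘ Linked.map child-deeper

  ascending-unique : ∀ {L} → Linked ChildOf L → Unique L
  ascending-unique = strict-chain-unique (flip <-trans) (<-irrefl refl) ∘ Linked.map child-deeper

  treeGraph : Graph n
  treeGraph = record
    { Adj    = TreeEdge
    ; sym    = Sum.swap
    ; irrefl = λ { (inj₁ c) → shallower⇒≢ (child-deeper c) refl
                 ; (inj₂ c) → shallower⇒≢ (child-deeper c) refl }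
    }

  climb : ∀ m v → depth v ≡ m → Star TreeEdge v root
  climb m v d with v ≟ root
  climb m       v d | yes refl = ε
  climb zero    v d | no v≢root with () ← trans (depth-parent v v≢root) d
  climb (suc m) v d | no v≢root =
    inj₁ (v≢root , refl) ◅ climb m (parent v) (suc-injective (trans (depth-parent v v≢root) d))

  connected : Connected treeGraph
  connected u v = star⇒linked (climb _ u refl ◅◅ Star.reverse (Graph.sym treeGraph) (climb _ v refl))

  descend : ∀ a b L → NoBacktrack (a ∷ b ∷ L) → Linked TreeEdge (a ∷ b ∷ L) → ChildOf b a →
            Linked (flip ChildOf) (a ∷ b ∷ L)
  descend a b []      _          _           down = down ∷ [-]
  descend a b (c ∷ L) (a≢c , nb) (_ ∷ e ∷ es) down with e
  ... | inj₂ down′ = down ∷ descend b c L nb (e ∷ es) down′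
  ... | inj₁ up    = ⊥-elim (a≢c (trans (sym (proj₂ down)) (proj₂ up)))

  climb-or-descend : ∀ a b L → NoBacktrack (a ∷ b ∷ L) → Linked TreeEdge (a ∷ b ∷ L) →
                     Linked ChildOf (a ∷ b ∷ L) ⊎ LastLink (flip ChildOf) (a ∷ b ∷ L)
  climb-or-descend a b []      _          (inj₁ up ∷ _)   = inj₁ (up ∷ [-])
  climb-or-descend a b []      _          (inj₂ down ∷ _) = inj₂ down
  climb-or-descend a b (c ∷ L) (a≢c , nb) (e ∷ es) with climb-or-descend b c L nb es
  ... | inj₂ last = inj₂ last
  ... | inj₁ ups@(up ∷ _) with e
  ...   | inj₁ up′  = inj₁ (up′ ∷ ups)
  ...   | inj₂ down = ⊥-elim (a≢c (trans (sym (proj₂ down)) (proj₂ up)))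

  -- A cycle can neither climb nor descend throughout, and climbing first then descending
  -- last would reach the parent of its base point twice.
  acyclic : ¬ HasCycle treeGraph
  acyclic (u , [] , () , _)
  acyclic (u , _ ∷ [] , s≤s () , _)
  acyclic (u , x₁ ∷ x₂ ∷ xs , _ , un@(u∉ ∷ x₁∉ ∷ _) , walk@(e ∷ _))
    with nb ← no-backtrack-∷ʳ u x₁ x₂ xs un (All.map ≢-sym u∉) | e
  ... | inj₂ down = closed-not-unique (x₁ ∷ x₂ ∷ xs) (descending-unique (descend u x₁ _ nb walk down))
  ... | inj₁ up with climb-or-descend u x₁ _ nb walk
  ...   | inj₁ ups  = closed-not-unique (x₁ ∷ x₂ ∷ xs) (ascending-unique ups)
  ...   | inj₂ last with last-link-source x₁ x₂ xs u last
  ...     | w , w∈ , (_ , pu≡w) = All¬⇒¬Any x₁∉ (subst (_∈ x₂ ∷ xs) (trans (sym pu≡w) (proj₂ up)) w∈)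

  isTree : IsTree treeGraph
  isTree = nonempty root , connected , acyclic
    where nonempty : ∀ {m} → Fin m → 1 ≤ m
          nonempty zero    = s≤s z≤n
          nonempty (suc _) = s≤s z≤n

  -- z lies at depth at least two, so its grandparent exists
  Deep : Fin n → Set
  Deep z = z ≢ root × parent z ≢ root

  vertical : Fin n → List (Fin n)
  vertical z = parent (parent z) ∷ parent z ∷ z ∷ []

  vertical-chain : ∀ {z} → Deep z → Linked (flip ChildOf) (vertical z)
  vertical-chain (z≢root , pz≢root) = (pz≢root , refl) ∷ (z≢root , refl) ∷ [-]

  vertical-path : ∀ {z} → Deep z → NontrivialPath treeGraph (vertical z)
  vertical-path dz =
    (Linked.map inj₂ (vertical-chain dz) , descending-unique (vertical-chain dz)) , s≤s (s≤s z≤n)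

  EdgeAbove : Fin n → Fin n → Fin n → Set
  EdgeAbove z x y = (x ≡ parent z × y ≡ z) ⊎ (x ≡ z × y ≡ parent z)

  edge-above-unique : ∀ {z z′ x y} → z ≢ root → z′ ≢ root → EdgeAbove z x y → EdgeAbove z′ x y → z ≡ z′
  edge-above-unique _    _     (inj₁ (_ , refl)) (inj₁ (_ , y≡z′)) = y≡z′
  edge-above-unique _    _     (inj₂ (refl , _)) (inj₂ (x≡z′ , _)) = x≡z′
  edge-above-unique z≢r z′≢r (inj₁ (refl , refl)) (inj₂ (pz≡z′ , z≡pz′)) =
    ⊥-elim (no-mutual-children (z≢r , pz≡z′) (z′≢r , sym z≡pz′))
  edge-above-unique z≢r z′≢r (inj₂ (refl , refl)) (inj₁ (z≡pz′ , pz≡z′)) =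
    ⊥-elim (no-mutual-children (z≢r , pz≡z′) (z′≢r , sym z≡pz′))

  vertical-edge : ∀ {z x y} → PathEdge (vertical z) x y → EdgeAbove (parent z) x y ⊎ EdgeAbove z x y
  vertical-edge (inj₁ c) with consec-three c
  ... | inj₁ (refl , refl) = inj₁ (inj₁ (refl , refl))
  ... | inj₂ (refl , refl) = inj₂ (inj₁ (refl , refl))
  vertical-edge (inj₂ c) with consec-three c
  ... | inj₁ (refl , refl) = inj₁ (inj₂ (refl , refl))
  ... | inj₂ (refl , refl) = inj₂ (inj₂ (refl , refl))

  parent-child-nonsplitting : ∀ {z z′} → Deep z′ → ChildOf z z′ → NonSplitting (vertical z′) (vertical z)
  parent-child-nonsplitting (pz≢root , ppz≢root) (z≢root , refl) =
    overlap-nonsplitting (descending-unique ((ppz≢root , refl) ∷ (pz≢root , refl) ∷ (z≢root , refl) ∷ [-]))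

  tree-edge⇒nonsplitting : ∀ {z z′} → Deep z → Deep z′ → TreeEdge z z′ →
                           NonSplitting (vertical z) (vertical z′)
  tree-edge⇒nonsplitting _  dz′ (inj₁ z→z′) = nonsplitting-sym (parent-child-nonsplitting dz′ z→z′)
  tree-edge⇒nonsplitting dz _   (inj₂ z′→z) = parent-child-nonsplitting dz z′→z

  siblings-branch : ∀ {z z′} → Deep z → Deep z′ → z ≢ z′ → parent z ≡ parent z′ →
                    HasBranch (vertical z) (vertical z′)
  siblings-branch {z} {z′} (z≢root , pz≢root) (z′≢root , pz′≢root) z≢z′ pz≡pz′ =
    parent z , parent (parent z) , z , z′ , ppz≢z , ppz≢z′ , z≢z′ ,
    inj₁ (inj₂ ([] , z ∷ [] , refl)) , inj₁ (inj₁ (parent (parent z) ∷ [] , [] , refl)) ,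
    inj₂ (inj₁ (parent (parent z′) ∷ [] , [] , cong (λ w → parent (parent z′) ∷ w ∷ z′ ∷ []) (sym pz≡pz′)))
    where
    grandparent-shallower : ∀ {v} → v ≢ root → parent v ≢ root → depth (parent (parent v)) < depth v
    grandparent-shallower v≢root pv≢root =
      <-trans (child-deeper (pv≢root , refl)) (child-deeper (v≢root , refl))
    ppz≢z : parent (parent z) ≢ z
    ppz≢z = shallower⇒≢ (grandparent-shallower z≢root pz≢root)
    ppz≢z′ : parent (parent z) ≢ z′
    ppz≢z′ = subst (_≢ z′) (cong parent (sym pz≡pz′)) (shallower⇒≢ (grandparent-shallower z′≢root pz′≢root))

  -- Conversely, non-splitting vertical paths of distinct vertices come from a tree edge:
  -- the edge they share lies above one vertex of each, and the only non-branching
  -- coincidence is that one vertex is the other's parent.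
  nonsplitting⇒tree-edge : ∀ {z z′} → Deep z → Deep z′ → z ≢ z′ →
                           NonSplitting (vertical z) (vertical z′) → TreeEdge z z′
  nonsplitting⇒tree-edge dz@(z≢root , pz≢root) dz′@(z′≢root , pz′≢root) z≢z′ ((_ , _ , e , e′) , no-branch)
    with vertical-edge e | vertical-edge e′
  ... | inj₁ above | inj₁ above′ =
    ⊥-elim (no-branch (siblings-branch dz dz′ z≢z′ (edge-above-unique pz≢root pz′≢root above above′)))
  ... | inj₁ above | inj₂ above′ = inj₁ (z≢root , edge-above-unique pz≢root z′≢root above above′)
  ... | inj₂ above | inj₁ above′ = inj₂ (z′≢root , sym (edge-above-unique z≢root pz′≢root above above′))
  ... | inj₂ above | inj₂ above′ = ⊥-elim (z≢z′ (edge-above-unique z≢root z′≢root above above′))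

  edge-above-on-vertical : ∀ {z z′} → z ≢ root → Deep z′ → PathEdge (vertical z′) (parent z) z →
                           z ≡ parent z′ ⊎ z ≡ z′
  edge-above-on-vertical z≢root (z′≢root , pz′≢root) e with vertical-edge e
  ... | inj₁ above′ = inj₁ (edge-above-unique z≢root pz′≢root (inj₁ (refl , refl)) above′)
  ... | inj₂ above′ = inj₂ (edge-above-unique z≢root z′≢root (inj₁ (refl , refl)) above′)

  vertical-distinct : ∀ {z z′} → Deep z → Deep z′ → z ≢ z′ → ¬ SameEdges (vertical z) (vertical z′)
  vertical-distinct {z} {z′} dz dz′ z≢z′ same
    with edge-above-on-vertical (proj₁ dz) dz′ (Equivalence.to (same _ _) (lowest-edge z))
       | edge-above-on-vertical (proj₁ dz′) dz (Equivalence.from (same _ _) (lowest-edge z′))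
    where
    lowest-edge : ∀ v → PathEdge (vertical v) (parent v) v
    lowest-edge v = inj₁ (parent (parent v) ∷ [] , [] , refl)
  ... | inj₂ z≡z′    | _            = z≢z′ z≡z′
  ... | _            | inj₂ z′≡z    = z≢z′ (sym z′≡z)
  ... | inj₁ z≡pz′   | inj₁ z′≡pz   = no-mutual-children (proj₁ dz , sym z′≡pz) (proj₁ dz′ , sym z≡pz′)

-- Breadth-first search from r roots a tree: the depth of v is its distance from r, and its
-- parent is the last vertex before v on a shortest walk from r.
module BreadthFirstRooting {n : ℕ} (G : Graph n) (connected : Connected G) (acyclic : ¬ HasCycle G)
                           (r : Fin n) where
  open Paths G

  Reach : ℕ → Fin n → Set
  Reach zero    v = v ≡ r
  Reach (suc m) v = ∃[ u ] (Reach m u × Adj G u v)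

  reach? : ∀ m v → Dec (Reach m v)
  reach? zero    v = v ≟ r
  reach? (suc m) v = any? λ u → reach? m u ×-dec adjacent? connected acyclic u v

  reachable : ∀ v → ∃[ m ] Reach m v
  reachable v with connected r v
  ... | inj₁ refl     = 0 , refl
  ... | inj₂ (xs , l) = along r xs 0 refl l
    where
    along : ∀ y xs m → Reach m y → Linked (Adj G) (y ∷ xs ∷ʳ v) → ∃[ m′ ] Reach m′ v
    along y []       m ry (a ∷ _) = suc m , y , ry , a
    along y (x ∷ xs) m ry (a ∷ l) = along x xs (suc m) (y , ry , a) l

  distance : ∀ v → ∃ (Least (λ m → Reach m v))
  distance v = least (λ m → reach? m v) (proj₂ (reachable v))

  depth : Fin n → ℕ
  depth v = proj₁ (distance v)

  reach-depth : ∀ v → Reach (depth v) v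
  reach-depth v = proj₁ (proj₂ (distance v))

  depth-minimal : ∀ v m → Reach m v → depth v ≤ m
  depth-minimal v = proj₂ (proj₂ (distance v))

  depth-step : ∀ {u v} → Adj G u v → depth v ≤ suc (depth u)
  depth-step {u} {v} a = depth-minimal v (suc (depth u)) (u , reach-depth u , a)

  predecessor : ∀ v → v ≡ r ⊎ ∃[ u ] (Adj G u v × suc (depth u) ≡ depth v)
  predecessor v = last-step (depth v) (reach-depth v) (depth-minimal v)
    where
    last-step : ∀ m → Reach m v → (∀ j → Reach j v → m ≤ j) → v ≡ r ⊎ ∃[ u ] (Adj G u v × suc (depth u) ≡ m)
    last-step zero    v≡r          _       = inj₁ v≡r
    last-step (suc m) (u , ru , a) minimal =
      inj₂ (u , a , cong suc (≤-antisym (depth-minimal u m ru) (≤-pred (minimal _ (u , reach-depth u , a)))))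

  parent : Fin n → Fin n
  parent v = [ (λ _ → r) , proj₁ ] (predecessor v)

  parent-step : ∀ v → v ≢ r → Adj G (parent v) v × suc (depth (parent v)) ≡ depth v
  parent-step v v≢r with predecessor v
  ... | inj₁ v≡r          = ⊥-elim (v≢r v≡r)
  ... | inj₂ (_ , a , d≡) = a , d≡

  parent-adj : ∀ {v} → v ≢ r → Adj G (parent v) v
  parent-adj {v} = proj₁ ∘ parent-step v

  rooting : Rooting n
  rooting = record
    { root = r ; parent = parent ; depth = depth
    ; depth-root = n≤0⇒n≡0 (depth-minimal r 0 refl)
    ; depth-parent = λ v v≢r → proj₂ (parent-step v v≢r)
    }

  open Rooted rooting using (ChildOf; TreeEdge)

  at-root : ∀ {v} → depth v ≡ 0 → v ≡ r
  at-root {v} d≡0 = subst (λ m → Reach m v) d≡0 (reach-depth v)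

  off-root : ∀ {v m} → depth v ≡ suc m → v ≢ r
  off-root d≡ refl with () ← trans (sym d≡) (Rooting.depth-root rooting)

  parent-depth : ∀ {v m} → depth v ≡ suc m → depth (parent v) ≡ m
  parent-depth {v} d≡ = suc-injective (trans (proj₂ (parent-step v (off-root d≡))) d≡)

  ≢-by-depth : ∀ {m x z} → depth x ≤ m → depth z ≡ suc m → x ≢ z
  ≢-by-depth {m} le dz refl = 1+n≰n (subst (_≤ m) dz le)

  join : ∀ m {a b} → depth a ≡ m → depth b ≡ m → a ≢ b →
         ∃[ ys ] (SimplePath a (parent a ∷ ys) b × All (λ x → depth x ≤ m) (a ∷ parent a ∷ ys ∷ʳ b))
  join zero    da db a≢b = ⊥-elim (a≢b (trans (at-root da) (sym (at-root db))))
  join (suc m) {a} {b} da db a≢b with parent a ≟ parent b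
  ... | yes pa≡pb =
    [] ,
    (Graph.sym G (parent-adj (off-root da)) ∷
       subst (λ w → Adj G w b) (sym pa≡pb) (parent-adj (off-root db)) ∷ [-] ,
     (≢-sym (≢-by-depth pa≤m da) ∷ a≢b ∷ []) ∷ (≢-by-depth pa≤m db ∷ []) ∷ [] ∷ []) ,
    ≤-reflexive da ∷ m≤n⇒m≤1+n pa≤m ∷ ≤-reflexive db ∷ []
    where
    pa≤m : depth (parent a) ≤ m
    pa≤m = ≤-reflexive (parent-depth da)
  ... | no pa≢pb with join m (parent-depth da) (parent-depth db) pa≢pb
  ...   | ys , p , shallow =
    (parent (parent a) ∷ ys) ∷ʳ parent b ,
    snoc-path (parent a ∷ parent (parent a) ∷ ys) from-a (parent-adj (off-root db)) b-fresh ,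
    ≤-reflexive da ∷ ∷ʳ⁺ (All.map m≤n⇒m≤1+n shallow) (≤-reflexive db)
    where
    -- a and b lie deeper than the path joining their parents, so neither is on it
    from-a : SimplePath a (parent a ∷ parent (parent a) ∷ ys) (parent b)
    from-a = cons-path (parent (parent a) ∷ ys) (Graph.sym G (parent-adj (off-root da)))
                       (All.map (λ le → ≢-sym (≢-by-depth le da)) shallow) p
    b-fresh : All (_≢ b) (a ∷ parent a ∷ parent (parent a) ∷ ys ∷ʳ parent b)
    b-fresh = a≢b ∷ All.map (λ le → ≢-by-depth le db) shallow

  -- A neighbour one level deeper is a child: a different parent would be joined to the
  -- neighbour at its own depth, and the path closes a cycle through the deeper vertex.
  deeper-neighbour : ∀ {u v} → Adj G u v → depth u < depth v → ChildOf v u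
  deeper-neighbour {u} {v} a du<dv = child (parent v ≟ u)
    where
    dv : depth v ≡ suc (depth u)
    dv = ≤-antisym (depth-step a) du<dv
    child : Dec (parent v ≡ u) → ChildOf v u
    child (yes pv≡u) = off-root dv , pv≡u
    child (no pv≢u) with ys , p , shallow ← join (depth u) refl (parent-depth dv) (≢-sym pv≢u) =
      ⊥-elim (acyclic (close-cycle (snoc-path (parent u ∷ ys) p (parent-adj (off-root dv))
                                              (All.map (λ le → ≢-by-depth le dv) shallow))
                                   (Graph.sym G a)))

  -- Every edge of the tree joins a vertex to its parent; neighbours at equal depth would be
  -- joined by a second path and close a cycle.
  edge⇒tree-edge : ∀ {u v} → Adj G u v → TreeEdge u v
  edge⇒tree-edge {u} {v} a with <-cmp (depth u) (depth v)
  ... | tri< du<dv _ _ = inj₂ (deeper-neighbour a du<dv)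
  ... | tri> _ _ dv<du = inj₁ (deeper-neighbour (Graph.sym G a) dv<du)
  ... | tri≈ _ du≡dv _ with _ , p , _ ← join (depth u) refl (sym du≡dv) (λ { refl → irrefl G a }) =
    ⊥-elim (acyclic (close-cycle p (Graph.sym G a)))

  tree-edge⇒edge : ∀ {u v} → TreeEdge u v → Adj G u v
  tree-edge⇒edge (inj₁ (u≢r , refl)) = Graph.sym G (parent-adj u≢r)
  tree-edge⇒edge (inj₂ (v≢r , refl)) = parent-adj v≢r

addRoot : ∀ {n} → Rooting n → Rooting (suc n)
addRoot {n} ρ = record
  { root = zero ; parent = parent′ ; depth = depth′ ; depth-root = refl ; depth-parent = depth-parent′ }
  where
  open Rooting ρ
  lifted-parent : ∀ {v} → Dec (v ≡ root) → Fin (suc n)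
  lifted-parent     (yes _) = zero
  lifted-parent {v} (no _)  = suc (parent v)
  parent′ : Fin (suc n) → Fin (suc n)
  parent′ zero    = zero
  parent′ (suc v) = lifted-parent (v ≟ root)
  depth′ : Fin (suc n) → ℕ
  depth′ zero    = 0
  depth′ (suc v) = suc (depth v)
  depth-parent′ : ∀ v → v ≢ zero → suc (depth′ (parent′ v)) ≡ depth′ v
  depth-parent′ zero    0≢0 = ⊥-elim (0≢0 refl)
  depth-parent′ (suc v) _   with v ≟ root
  ... | yes refl     = cong suc (sym depth-root)
  ... | no  v≢root   = cong suc (depth-parent v v≢root)

module _ {n : ℕ} (ρ : Rooting n) where
  open Rooted ρ
  private module ρ⁺ = Rooted (addRoot ρ)

  addRoot-parent : ∀ {v} → v ≢ root → ρ⁺.parent (suc v) ≡ suc (parent v)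
  addRoot-parent {v} v≢root with v ≟ root
  ... | yes v≡root = ⊥-elim (v≢root v≡root)
  ... | no  _      = refl

  addRoot-child : ∀ {v w} → ρ⁺.ChildOf (suc v) (suc w) ⇔ ChildOf v w
  addRoot-child {v} = mk⇔ to (λ (v≢root , pv≡w) → (λ ()) , trans (addRoot-parent v≢root) (cong suc pv≡w))
    where
    to : ∀ {w} → ρ⁺.ChildOf (suc v) (suc w) → ChildOf v w
    to (_ , p⁺≡) with v ≟ root
    to (_ , ())  | yes _
    to (_ , p⁺≡) | no v≢root = v≢root , Finₚ.suc-injective p⁺≡

  addRoot-tree-edge : ∀ {u v} → ρ⁺.TreeEdge (suc u) (suc v) ⇔ TreeEdge u v
  addRoot-tree-edge = mk⇔ (Sum.map (Equivalence.to addRoot-child) (Equivalence.to addRoot-child))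
                          (Sum.map (Equivalence.from addRoot-child) (Equivalence.from addRoot-child))

-- Every rooted tree is an ENPT graph: below a stem of two new roots every old vertex is deep,
-- and the vertical paths of the old vertices realise exactly the old tree edges.
module Stem {n : ℕ} (ρ : Rooting n) where
  host : Rooting (suc (suc n))
  host = addRoot (addRoot ρ)

  open Rooted host

  lift : Fin n → Fin (suc (suc n))
  lift v = suc (suc v)

  lift-≢ : ∀ {u v} → u ≢ v → lift u ≢ lift v
  lift-≢ u≢v refl = u≢v refl

  lift-deep : ∀ v → Deep (lift v)
  lift-deep v = (λ ()) , subst (_≢ zero) (sym (addRoot-parent (addRoot ρ) {suc v} (λ ()))) (λ ())

  lift-tree-edge : ∀ {u v} → TreeEdge (lift u) (lift v) ⇔ Rooted.TreeEdge ρ u v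
  lift-tree-edge =
    mk⇔ (Equivalence.to (addRoot-tree-edge ρ) ∘ Equivalence.to (addRoot-tree-edge (addRoot ρ)))
        (Equivalence.from (addRoot-tree-edge (addRoot ρ)) ∘ Equivalence.from (addRoot-tree-edge ρ))

  paths : Fin n → List (Fin (suc (suc n)))
  paths = vertical ∘ lift

  enpt⇔tree-edge : ∀ u v → ENPTAdj paths u v ⇔ Rooted.TreeEdge ρ u v
  enpt⇔tree-edge u v = mk⇔
    (λ (u≢v , ns) →
       Equivalence.to lift-tree-edge (nonsplitting⇒tree-edge (lift-deep u) (lift-deep v) (lift-≢ u≢v) ns))
    (λ e → (λ { refl → Graph.irrefl (Rooted.treeGraph ρ) e }) ,
           tree-edge⇒nonsplitting (lift-deep u) (lift-deep v) (Equivalence.from lift-tree-edge e))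

lemma2 : ∀ {k} (T' : Graph k) → IsTree T' →
    ∃[ N ] Σ (Graph N) λ T → IsTree T × (∃[ m ] Σ (Fin m → List (Fin N)) λ P →
    (∀ i → NontrivialPath T (P i)) ×
    (∀ i j → i ≢ j → ¬ SameEdges (P i) (P j)) ×
    IsoENPT T' P)
lemma2 {zero}  T' (() , _)
lemma2 {suc k} T' (_ , connected , acyclic) =
  _ , treeGraph , isTree , suc k , paths ,
  (λ v → vertical-path (lift-deep v)) ,
  (λ u v u≢v → vertical-distinct (lift-deep u) (lift-deep v) (lift-≢ u≢v)) ,
  ↔-id _ ,
  λ u v → mk⇔ (Equivalence.from (enpt⇔tree-edge u v) ∘ edge⇒tree-edge)
              (tree-edge⇒edge ∘ Equivalence.to (enpt⇔tree-edge u v))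
  where
  open BreadthFirstRooting T' connected acyclic zero using (rooting; edge⇒tree-edge; tree-edge⇒edge)
  open Stem rooting
  open Rooted host using (treeGraph; isTree; vertical-path; vertical-distinct)
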